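{- Let $G=(V,E)$, $d$, $w$ be as in the context, and let $D\in\mathcal{D}_f$ and $e\in E$. Then at least one of the following holds: (i) $D\oplus e\in\mathcal{D}_f$ and $A(D\oplus e)=A(D)$; (ii) $D\oplus\overleftarrow{e}\in\mathcal{D}_f$ and $A(D\oplus\overleftarrow{e})=A(D)$.
   Context: $G=(V,E)$ is a finite simple graph regarded as a digraph whose arc set $E$ contains both arcs $e=(u,v)$ and $\overleftarrow{e}=(v,u)$ of each undirected edge. $d:V\to\mathbb{Z}$ is an integer demand ($\sum_u d(u)=0$) and $w:E\to(0,\infty)$ a cost function. A $d$-flow is $f:E\to[0,1]$ with $\sum_{v\sim u}\big(f((u,v))-f((v,u))\big)=d(u)$ for all $u$; it is a flow on $D\subseteq E$ if $f$ vanishes outside $D$. $\mathcal{D}_f$ is the set of $D\subseteq E$ on which a $d$-flow exists. The cost is $|f|_w=\sum_e w(e)|f(e)|$. Standing assumption: for each $D\in\mathcal{D}_f$ the minimum-cost $d$-flow on $D$ is unique; it is $\{0,1\}$-valued (integrality) and is denoted $A(D)$, identified with the set of arcs carrying flow $1$. Notation: $D\oplus e:=(D\cup\{e\})\setminus\{\overleftarrow{e}\}$. -}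

module Defs where

open import Level using (0ℓ)
open import Data.Nat using (ℕ; zero; suc)
open import Data.Integer as ℤ using (ℤ; +_; -[1+_])
open import Data.Fin using (Fin; zero; suc)
open import Data.Fin.Properties using (_≟_)
open import Data.Bool using (Bool; true; false; if_then_else_; _∧_)
open import Data.Product using (Σ; _×_; _,_; proj₁)
open import Data.Sum using (_⊎_)
open import Relation.Nullary using (¬_; does; yes; no)
open import Relation.Binary.PropositionalEquality using (_≡_; _≢_; refl; trans)
open import Relation.Binary.Structures using (IsTotalOrder)
import Algebra.Structures as AS
open import Function.Bundles using (_⇔_)

-- Scalars: an ordered field (the real numbers ℝ are an instance).
-- Equality is propositional equality.

record OrderedField : Set₁ where
  infixl 6 _+_
  infixl 7 _*_
  infix 4 _≤_ _<_
  field
    Carrier : Set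
    _+_ _*_ : Carrier → Carrier → Carrier
    -_      : Carrier → Carrier
    0# 1#   : Carrier
    _≤_     : Carrier → Carrier → Set
    isCommutativeRing : AS.IsCommutativeRing _≡_ _+_ _*_ -_ 0# 1#
    0≢1     : 0# ≢ 1#
    inverse : ∀ x → x ≢ 0# → Σ Carrier λ y → x * y ≡ 1#
    isTotalOrder : IsTotalOrder _≡_ _≤_
    +-mono-≤ : ∀ {x y} z → x ≤ y → x + z ≤ y + z
    *-nonneg : ∀ {x y} → 0# ≤ x → 0# ≤ y → 0# ≤ x * y

  _<_ : Carrier → Carrier → Set
  x < y = (x ≤ y) × (x ≢ y)

  _-_ : Carrier → Carrier → Carrier
  x - y = x + (- y)

  fromℕ : ℕ → Carrier
  fromℕ zero    = 0#
  fromℕ (suc n) = 1# + fromℕ n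

  fromℤ : ℤ → Carrier
  fromℤ (+ n)      = fromℕ n
  fromℤ -[1+ n ]   = - (1# + fromℕ n)

  ∑ : ∀ {n} → (Fin n → Carrier) → Carrier
  ∑ {zero}  f = 0#
  ∑ {suc n} f = f zero + ∑ (λ i → f (suc i))

∑ℤ : ∀ {n} → (Fin n → ℤ) → ℤ
∑ℤ {zero}  f = + 0
∑ℤ {suc n} f = f zero ℤ.+ ∑ℤ (λ i → f (suc i))

-- Finite simple graphs on vertex set Fin n, viewed as symmetric digraphs.
-- The arc set E consists of all (u , v) with adj u v ≡ true.

record SimpleGraph (n : ℕ) : Set where
  field
    adj   : Fin n → Fin n → Bool
    sym   : ∀ u v → adj u v ≡ adj v u
    irrefl : ∀ u → adj u u ≡ false

record Arc {n} (G : SimpleGraph n) : Set where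
  constructor arc
  field
    tl hd : Fin n
    isArc : SimpleGraph.adj G tl hd ≡ true

ArcSet : ℕ → Set
ArcSet n = Fin n → Fin n → Bool

_⊆E_ : ∀ {n} → ArcSet n → SimpleGraph n → Set
D ⊆E G = ∀ u v → D u v ≡ true → SimpleGraph.adj G u v ≡ true

-- D ⊕ e := (D ∪ {e}) ∖ {reverse e}, for e = (a , b)  (a ≠ b)
_⊕_ : ∀ {n} {G : SimpleGraph n} → ArcSet n → Arc G → ArcSet n
(D ⊕ arc a b _) u v =
  if does (u ≟ a) ∧ does (v ≟ b) then true
  else if does (u ≟ b) ∧ does (v ≟ a) then false
  else D u v

rev : ∀ {n} {G : SimpleGraph n} → Arc G → Arc G
rev {G = G} (arc u v p) = arc v u (trans (SimpleGraph.sym G v u) p)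

module Flows (F : OrderedField) {n : ℕ} (G : SimpleGraph n) where
  open OrderedField F
  open SimpleGraph G

  -- functions on arcs, represented as functions on Fin n × Fin n
  -- (values at non-arcs are required to be 0 where relevant)
  ArcFun : Set
  ArcFun = Fin n → Fin n → Carrier

  IsDFlow : (Fin n → ℤ) → ArcFun → Set
  IsDFlow d f =
      (∀ u v → adj u v ≡ true → (0# ≤ f u v) × (f u v ≤ 1#))
    × (∀ u v → adj u v ≡ false → f u v ≡ 0#)
    × (∀ u → ∑ (λ v → f u v - f v u) ≡ fromℤ (d u))

  IsDFlowOn : (Fin n → ℤ) → ArcSet n → ArcFun → Set
  IsDFlowOn d D f = IsDFlow d f × (∀ u v → D u v ≡ false → f u v ≡ 0#)

  InDf : (Fin n → ℤ) → ArcSet n → Set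
  InDf d D = Σ ArcFun (IsDFlowOn d D)

  -- |f|_w = Σ_e w(e) |f(e)|  (sum over arcs; f ≥ 0 on arcs, so |f(e)| = f(e))
  cost : ArcFun → ArcFun → Carrier
  cost w f = ∑ λ u → ∑ λ v → if adj u v then w u v * f u v else 0#

  IsMinCostOn : (Fin n → ℤ) → ArcFun → ArcSet n → ArcFun → Set
  IsMinCostOn d w D f =
    IsDFlowOn d D f × (∀ g → IsDFlowOn d D g → cost w f ≤ cost w g)

  -- Standing assumption: for each D ∈ 𝒟_f (D ⊆ E) the minimum-cost d-flow
  -- on D exists, is unique and is {0,1}-valued.  A(D) is that flow.
  StandingAssumption : (Fin n → ℤ) → ArcFun → Set
  StandingAssumption d w =
    ∀ D → D ⊆E G → InDf d D →
      Σ ArcFun λ f → IsMinCostOn d w D f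
        × (∀ g → IsMinCostOn d w D g → ∀ u v → g u v ≡ f u v)
        × (∀ u v → (f u v ≡ 0#) ⊎ (f u v ≡ 1#))

  A : ∀ d w → StandingAssumption d w →
      (D : ArcSet n) → D ⊆E G → InDf d D → (Fin n → Fin n → Set)
  A d w H D s p u v = proj₁ (H D s p) u v ≡ 1#

  SameArcs : (Fin n → Fin n → Set) → (Fin n → Fin n → Set) → Set
  SameArcs X Y = ∀ u v → X u v ⇔ Y u v

  false≢true : ∀ {X : Set} → false ≡ true → X
  false≢true ()

  ⊕-⊆E : ∀ D (e : Arc G) → D ⊆E G → (D ⊕ e) ⊆E G
  ⊕-⊆E D (arc a b ab) s u v h with u ≟ a | v ≟ b
  ... | yes refl | yes refl = ab
  ... | yes _ | no _ with u ≟ b | v ≟ a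
  ...   | yes _ | yes _ = false≢true h
  ...   | yes _ | no _ = s u v h
  ...   | no _ | _ = s u v h
  ⊕-⊆E D (arc a b ab) s u v h | no _ | _ with u ≟ b | v ≟ a
  ... | yes refl | yes refl = trans (sym u v) ab
  ... | yes _ | no _ = s u v h
  ... | no _ | _ = s u v h

-- Let f = A(D) and e = (a , b).  If f carries 1 on both a → b and b → a,
-- cancelling this 2-cycle yields a strictly cheaper d-flow on D (weights are
-- positive), which is impossible.  If f(b , a) = 0, then f is a flow on D ⊕ e,
-- and whenever A(D ⊕ e) is a flow on D (automatic if f(a , b) = 1, since then
-- (a , b) ∈ D; otherwise it means A(D ⊕ e) vanishes on (a , b)) we get
-- cost f ≤ cost A(D ⊕ e) ≤ cost of every flow on D ⊕ e, so f is a min-cost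
-- flow on D ⊕ e and uniqueness gives A(D ⊕ e) = A(D); symmetrically for the
-- reversed arc.  In the one remaining case f vanishes on both arcs while
-- A(D ⊕ e) and A(D ⊕ ē) both use their added arc; their average is a d-flow
-- costing at most cost f that carries ½ on both arcs of e and otherwise lives
-- in D, and cancelling that 2-cycle again undercuts f.

module Submission where

open import Level using (0ℓ)
open import Defs
open import Data.Nat using (ℕ; zero; suc)
open import Data.Integer using (ℤ; +_)
open import Data.Fin using (Fin; zero; suc; punchIn)
open import Data.Fin.Properties using (_≟_; punchInᵢ≢i)
open import Data.Bool using (Bool; true; false; if_then_else_)
open import Data.Product using (Σ; _×_; _,_; proj₁; proj₂; swap)
open import Data.Sum using (_⊎_; inj₁; inj₂)
open import Data.Empty using (⊥; ⊥-elim)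
open import Function.Base using (_∘_)
open import Function.Bundles using (mk⇔)
open import Relation.Nullary using (¬_; does; yes; no)
open import Relation.Nullary.Decidable using (dec-true; dec-false; _×-dec_)
open import Relation.Binary.PropositionalEquality
open import Relation.Binary.Structures using (IsTotalOrder)
open import Algebra.Bundles using (CommutativeRing)
import Algebra.Properties.Ring as RingProperties
import Algebra.Properties.Semiring.Sum as SemiringSum
import Algebra.Solver.CommutativeMonoid as CommutativeMonoidSolver

module OrderedFieldProperties (F : OrderedField) where
  open OrderedField F

  commutativeRing : CommutativeRing 0ℓ 0ℓ
  commutativeRing = record { isCommutativeRing = isCommutativeRing }

  open CommutativeRing commutativeRing public
    using ( +-comm; +-identityˡ; +-identityʳ; -‿inverseʳ
          ; *-assoc; *-comm; *-identityˡ; *-identityʳ; distribˡ; distribʳ; zeroʳ )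
  open RingProperties (CommutativeRing.ring commutativeRing) public
    using ( -‿distribˡ-*; -‿distribʳ-*; -‿involutive; -‿+-comm; x[y-z]≈xy-xz
          ; +-identityʳ-unique; x≈y⇒x∙y⁻¹≈ε; //-rightDividesˡ )
  open IsTotalOrder isTotalOrder public
    using (total) renaming (refl to ≤-refl; trans to ≤-trans; antisym to ≤-antisym)
  module Sum = SemiringSum (CommutativeRing.semiring commutativeRing)
  open CommutativeMonoidSolver (CommutativeRing.+-commutativeMonoid commutativeRing)
    using (solve; _⊜_) renaming (_⊕_ to _⊞_)
  open ≡-Reasoning

  +-monoʳ-≤ : ∀ z {x y} → x ≤ y → z + x ≤ z + y
  +-monoʳ-≤ z {x} {y} x≤y = subst₂ _≤_ (+-comm x z) (+-comm y z) (+-mono-≤ z x≤y)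

  +-mono-≤₂ : ∀ {x x′ y y′} → x ≤ x′ → y ≤ y′ → x + y ≤ x′ + y′
  +-mono-≤₂ {x′ = x′} {y} x≤x′ y≤y′ = ≤-trans (+-mono-≤ y x≤x′) (+-monoʳ-≤ x′ y≤y′)

  x≤y⇒0≤y-x : ∀ {x y} → x ≤ y → 0# ≤ y - x
  x≤y⇒0≤y-x {x} {y} x≤y = subst (_≤ y - x) (-‿inverseʳ x) (+-mono-≤ (- x) x≤y)

  0≤y-x⇒x≤y : ∀ {x y} → 0# ≤ y - x → x ≤ y
  0≤y-x⇒x≤y {x} {y} 0≤y-x =
    subst₂ _≤_ (+-identityˡ x) (//-rightDividesˡ x y) (+-mono-≤ x 0≤y-x)

  +-nonneg : ∀ {x y} → 0# ≤ x → 0# ≤ y → 0# ≤ x + y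
  +-nonneg 0≤x 0≤y = subst (_≤ _) (+-identityˡ 0#) (+-mono-≤₂ 0≤x 0≤y)

  *-monoʳ-≤-nonneg : ∀ {c x y} → 0# ≤ c → x ≤ y → c * x ≤ c * y
  *-monoʳ-≤-nonneg {c} {x} {y} 0≤c x≤y =
    0≤y-x⇒x≤y (subst (0# ≤_) (x[y-z]≈xy-xz c y x) (*-nonneg 0≤c (x≤y⇒0≤y-x x≤y)))

  0≤x*x : ∀ x → 0# ≤ x * x
  0≤x*x x with total 0# x
  ... | inj₁ 0≤x = *-nonneg 0≤x 0≤x
  ... | inj₂ x≤0 = subst (0# ≤_) -x*-x≡x*x (*-nonneg 0≤-x 0≤-x)
    where
    0≤-x : 0# ≤ - x
    0≤-x = subst (0# ≤_) (+-identityˡ (- x)) (x≤y⇒0≤y-x x≤0)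
    -x*-x≡x*x : - x * - x ≡ x * x
    -x*-x≡x*x = begin
      - x * - x      ≡⟨ -‿distribˡ-* x (- x) ⟨
      - (x * - x)    ≡⟨ cong -_ (-‿distribʳ-* x x) ⟨
      - - (x * x)    ≡⟨ -‿involutive (x * x) ⟩
      x * x          ∎

  0≤1 : 0# ≤ 1#
  0≤1 = subst (0# ≤_) (*-identityˡ 1#) (0≤x*x 1#)

  0<1 : 0# < 1#
  0<1 = 0≤1 , 0≢1

  <-trans : ∀ {x y z} → x < y → y < z → x < z
  <-trans (x≤y , x≢y) (y≤z , y≢z) =
    ≤-trans x≤y y≤z , λ { refl → x≢y (≤-antisym x≤y y≤z) }

  ≤-<-trans : ∀ {x y z} → x ≤ y → y < z → x < z
  ≤-<-trans x≤y (y≤z , y≢z) =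
    ≤-trans x≤y y≤z , λ { refl → y≢z (≤-antisym y≤z x≤y) }

  <⇒≱ : ∀ {x y} → x < y → ¬ (y ≤ x)
  <⇒≱ (x≤y , x≢y) y≤x = x≢y (≤-antisym x≤y y≤x)

  x<x+y : ∀ x {y} → 0# < y → x < x + y
  x<x+y x {y} (0≤y , 0≢y) =
    subst (_≤ x + y) (+-identityʳ x) (+-monoʳ-≤ x 0≤y) ,
    λ x≡x+y → 0≢y (sym (+-identityʳ-unique x y (sym x≡x+y)))

  +-pos : ∀ {x y} → 0# < x → 0# < y → 0# < x + y
  +-pos {x} 0<x 0<y = <-trans 0<x (x<x+y x 0<y)

  x*y≡0⇒y≡0 : ∀ {x y} → x ≢ 0# → x * y ≡ 0# → y ≡ 0#
  x*y≡0⇒y≡0 {x} {y} x≢0 xy≡0 with inverse x x≢0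
  ... | x⁻¹ , xx⁻¹≡1 = begin
    y               ≡⟨ *-identityˡ y ⟨
    1# * y          ≡⟨ cong (_* y) (trans (sym xx⁻¹≡1) (*-comm x x⁻¹)) ⟩
    x⁻¹ * x * y     ≡⟨ *-assoc x⁻¹ x y ⟩
    x⁻¹ * (x * y)   ≡⟨ cong (x⁻¹ *_) xy≡0 ⟩
    x⁻¹ * 0#        ≡⟨ zeroʳ x⁻¹ ⟩
    0#              ∎

  *-pos : ∀ {x y} → 0# < x → 0# < y → 0# < x * y
  *-pos (0≤x , 0≢x) (0≤y , 0≢y) =
    *-nonneg 0≤x 0≤y , λ 0≡xy → 0≢y (sym (x*y≡0⇒y≡0 (0≢x ∘ sym) (sym 0≡xy)))

  -- _-_ has no fixity declaration in Defs, so it binds tighter than _*_.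
  c*[x+y]-c*[x′+y′] : ∀ c x y x′ y′ →
                      (c * (x + y)) - (c * (x′ + y′)) ≡ c * ((x - x′) + (y - y′))
  c*[x+y]-c*[x′+y′] c x y x′ y′ = begin
    (c * (x + y)) - (c * (x′ + y′))  ≡⟨ x[y-z]≈xy-xz c (x + y) (x′ + y′) ⟨
    c * ((x + y) - (x′ + y′))        ≡⟨ cong (λ t → c * ((x + y) + t)) (-‿+-comm x′ y′) ⟨
    c * ((x + y) + (- x′ + - y′))    ≡⟨ cong (c *_) (interchange x y (- x′) (- y′)) ⟩
    c * ((x - x′) + (y - y′))        ∎
    where
    interchange : ∀ p q r s → (p + q) + (r + s) ≡ (p + r) + (q + s)
    interchange = solve 4 (λ p q r s → (p ⊞ q) ⊞ (r ⊞ s) ⊜ (p ⊞ r) ⊞ (q ⊞ s)) refl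

  2≢0 : 1# + 1# ≢ 0#
  2≢0 2≡0 = 0≢1 (≤-antisym 0≤1 (subst (1# ≤_) 2≡0 1≤2))
    where
    1≤2 : 1# ≤ 1# + 1#
    1≤2 = subst (_≤ 1# + 1#) (+-identityˡ 1#) (+-mono-≤ 1# 0≤1)

  ½ : Carrier
  ½ = proj₁ (inverse (1# + 1#) 2≢0)

  ½*[x+x]≡x : ∀ x → ½ * (x + x) ≡ x
  ½*[x+x]≡x x = begin
    ½ * (x + x)              ≡⟨ cong (½ *_) (cong₂ _+_ (*-identityˡ x) (*-identityˡ x)) ⟨
    ½ * (1# * x + 1# * x)    ≡⟨ cong (½ *_) (distribʳ x 1# 1#) ⟨
    ½ * ((1# + 1#) * x)      ≡⟨ *-assoc ½ (1# + 1#) x ⟨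
    ½ * (1# + 1#) * x        ≡⟨ cong (_* x) (trans (*-comm ½ _) (proj₂ (inverse (1# + 1#) 2≢0))) ⟩
    1# * x                   ≡⟨ *-identityˡ x ⟩
    x                        ∎

  0<½ : 0# < ½
  0<½ = 0≤½ , 0≢½
    where
    0≤½ : 0# ≤ ½
    0≤½ = subst (0# ≤_) (trans (sym (distribˡ ½ ½ ½)) (½*[x+x]≡x ½))
                (+-nonneg (0≤x*x ½) (0≤x*x ½))
    0≢½ : 0# ≢ ½
    0≢½ 0≡½ = 0≢1 (trans (sym (zeroʳ (1# + 1#))) (trans (cong ((1# + 1#) *_) 0≡½)
                   (proj₂ (inverse (1# + 1#) 2≢0))))

  ∑≡sum : ∀ {m} (f : Fin m → Carrier) → ∑ f ≡ Sum.sum f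
  ∑≡sum {zero}  f = refl
  ∑≡sum {suc m} f = cong (λ s → f zero + s) (∑≡sum (f ∘ suc))

  ∑-cong : ∀ {m} {f g : Fin m → Carrier} → (∀ i → f i ≡ g i) → ∑ f ≡ ∑ g
  ∑-cong {f = f} {g} f≗g = trans (∑≡sum f) (trans (Sum.sum-cong-≗ f≗g) (sym (∑≡sum g)))

  ∑-distrib-+ : ∀ {m} (f g : Fin m → Carrier) → ∑ (λ i → f i + g i) ≡ ∑ f + ∑ g
  ∑-distrib-+ f g = trans (∑≡sum (λ i → f i + g i))
    (trans (Sum.∑-distrib-+ f g) (sym (cong₂ _+_ (∑≡sum f) (∑≡sum g))))

  *-distribˡ-∑ : ∀ {m} c (f : Fin m → Carrier) → c * ∑ f ≡ ∑ (λ i → c * f i)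
  *-distribˡ-∑ c f = trans (cong (c *_) (∑≡sum f))
    (trans (Sum.*-distribˡ-sum c f) (sym (∑≡sum (λ i → c * f i))))

  sum-zero : ∀ {m} {f : Fin m → Carrier} → (∀ i → f i ≡ 0#) → Sum.sum f ≡ 0#
  sum-zero {m} f≡0 = trans (Sum.sum-cong-≗ f≡0) (Sum.sum-replicate-zero m)

  ∑-zero : ∀ {m} {f : Fin m → Carrier} → (∀ i → f i ≡ 0#) → ∑ f ≡ 0#
  ∑-zero {f = f} f≡0 = trans (∑≡sum f) (sum-zero f≡0)

  ∑-single : ∀ {m} {f : Fin m → Carrier} j → (∀ i → i ≢ j → f i ≡ 0#) → ∑ f ≡ f j
  ∑-single {suc m} {f} j f≡0 = begin
    ∑ f                            ≡⟨ ∑≡sum f ⟩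
    Sum.sum f                      ≡⟨ Sum.sum-remove f ⟩
    f j + Sum.sum (f ∘ punchIn j)  ≡⟨ cong (λ s → f j + s) (sum-zero (f≡0 _ ∘ punchInᵢ≢i j)) ⟩
    f j + 0#                       ≡⟨ +-identityʳ (f j) ⟩
    f j                            ∎

module _ {n : ℕ} where

  atArc : Fin n → Fin n → Fin n → Fin n → Bool
  atArc a b u v = does ((u ≟ a) ×-dec (v ≟ b))

  atArc-refl : ∀ a b → atArc a b a b ≡ true
  atArc-refl a b = dec-true ((a ≟ a) ×-dec (b ≟ b)) (refl , refl)

  atArc-off : ∀ {a b u v} → ¬ (u ≡ a × v ≡ b) → atArc a b u v ≡ false
  atArc-off {a} {b} {u} {v} = dec-false ((u ≟ a) ×-dec (v ≟ b))

  -- D ⊕ arc a b _ unfolds to  λ u v → caseArcs a b true false (D u v) u v.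
  caseArcs : {A : Set} → Fin n → Fin n → A → A → A → Fin n → Fin n → A
  caseArcs a b x y z u v = if atArc a b u v then x else if atArc b a u v then y else z

  module _ {A : Set} {a b : Fin n} {x y z : A} where

    caseArcs-forward : caseArcs a b x y z a b ≡ x
    caseArcs-forward = cong (λ c → if c then x else (if atArc b a a b then y else z)) (atArc-refl a b)

    caseArcs-backward : a ≢ b → caseArcs a b x y z b a ≡ y
    caseArcs-backward a≢b = trans
      (cong (λ c → if c then x else (if atArc b a b a then y else z))
            (atArc-off {a} {b} {b} {a} (a≢b ∘ sym ∘ proj₁)))
      (cong (λ c → if c then y else z) (atArc-refl b a))

    caseArcs-neither : ∀ {u v} → ¬ (u ≡ a × v ≡ b) → ¬ (u ≡ b × v ≡ a) →
                       caseArcs a b x y z u v ≡ z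
    caseArcs-neither {u} {v} ¬ab ¬ba = trans
      (cong (λ c → if c then x else (if atArc b a u v then y else z))
            (atArc-off {a} {b} {u} {v} ¬ab))
      (cong (λ c → if c then y else z) (atArc-off {b} {a} {u} {v} ¬ba))

  data ArcView (a b u v : Fin n) : Set where
    forward  : u ≡ a → v ≡ b → ArcView a b u v
    backward : u ≡ b → v ≡ a → ArcView a b u v
    neither  : ¬ (u ≡ a × v ≡ b) → ¬ (u ≡ b × v ≡ a) → ArcView a b u v

  arcView : ∀ a b u v → ArcView a b u v
  arcView a b u v with (u ≟ a) ×-dec (v ≟ b) | (u ≟ b) ×-dec (v ≟ a)
  ... | yes (u≡a , v≡b) | _                = forward u≡a v≡b
  ... | no _            | yes (u≡b , v≡a)  = backward u≡b v≡a
  ... | no ¬ab          | no ¬ba           = neither ¬ab ¬ba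

  caseArcs-elim : {A : Set} (P : A → Set) {a b : Fin n} {x y z : A} → a ≢ b → P x → P y →
                  ∀ u v → (¬ (u ≡ a × v ≡ b) → ¬ (u ≡ b × v ≡ a) → P z) →
                  P (caseArcs a b x y z u v)
  caseArcs-elim P {a} {b} a≢b px py u v pz with arcView a b u v
  ... | forward refl refl  = subst P (sym (caseArcs-forward {a = a} {b})) px
  ... | backward refl refl = subst P (sym (caseArcs-backward a≢b)) py
  ... | neither ¬ab ¬ba    = subst P (sym (caseArcs-neither ¬ab ¬ba)) (pz ¬ab ¬ba)

module FlowProperties (F : OrderedField) {n : ℕ} (G : SimpleGraph n) (d : Fin n → ℤ) where
  open OrderedField F
  open OrderedFieldProperties F
  open SimpleGraph G using (adj; irrefl) renaming (sym to adj-sym)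
  open Flows F G
  open ≡-Reasoning

  adj⇒≢ : ∀ {a b} → adj a b ≡ true → a ≢ b
  adj⇒≢ {a} ab refl = false≢true (trans (sym (irrefl a)) ab)

  adj-reverse : ∀ {a b} → adj a b ≡ true → adj b a ≡ true
  adj-reverse {a} {b} ab = trans (adj-sym b a) ab

  arcOf : ∀ {a b} → adj a b ≡ true → Arc G
  arcOf {a} {b} ab = arc a b ab

  weigh : ArcFun → ArcFun → Fin n → Fin n → Carrier
  weigh w g u v = if adj u v then w u v * g u v else 0#

  weigh-zero : ∀ w g {u v} → g u v ≡ 0# → weigh w g u v ≡ 0#
  weigh-zero w g {u} {v} g≡0 with adj u v
  ... | true  = trans (cong (w u v *_) g≡0) (zeroʳ (w u v))
  ... | false = refl

  cost-cong : ∀ w {g h} → (∀ u v → g u v ≡ h u v) → cost w g ≡ cost w h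
  cost-cong w g≗h = ∑-cong λ u → ∑-cong λ v →
    cong (λ x → if adj u v then w u v * x else 0#) (g≗h u v)

  cost-distrib-+ : ∀ w g h → cost w (λ u v → g u v + h u v) ≡ cost w g + cost w h
  cost-distrib-+ w g h = begin
    cost w (λ u v → g u v + h u v)
      ≡⟨ ∑-cong (λ u → ∑-cong (weigh-+ u)) ⟩
    ∑ (λ u → ∑ λ v → weigh w g u v + weigh w h u v)
      ≡⟨ ∑-cong (λ u → ∑-distrib-+ (weigh w g u) (weigh w h u)) ⟩
    ∑ (λ u → ∑ (weigh w g u) + ∑ (weigh w h u))
      ≡⟨ ∑-distrib-+ (λ u → ∑ (weigh w g u)) (λ u → ∑ (weigh w h u)) ⟩
    cost w g + cost w h
      ∎
    where
    weigh-+ : ∀ u v → weigh w (λ u v → g u v + h u v) u v ≡ weigh w g u v + weigh w h u v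
    weigh-+ u v with adj u v
    ... | true  = distribˡ (w u v) (g u v) (h u v)
    ... | false = sym (+-identityˡ 0#)

  cost-scale : ∀ w c g → cost w (λ u v → c * g u v) ≡ c * cost w g
  cost-scale w c g = begin
    cost w (λ u v → c * g u v)              ≡⟨ ∑-cong (λ u → ∑-cong (weigh-* u)) ⟩
    ∑ (λ u → ∑ λ v → c * weigh w g u v)     ≡⟨ ∑-cong (λ u → *-distribˡ-∑ c (weigh w g u)) ⟨
    ∑ (λ u → c * ∑ (weigh w g u))           ≡⟨ *-distribˡ-∑ c (λ u → ∑ (weigh w g u)) ⟨
    c * cost w g                            ∎
    where
    weigh-* : ∀ u v → weigh w (λ u v → c * g u v) u v ≡ c * weigh w g u v
    weigh-* u v with adj u v
    ... | true  = trans (sym (*-assoc (w u v) c (g u v)))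
                   (trans (cong (_* g u v) (*-comm (w u v) c)) (*-assoc c (w u v) (g u v)))
    ... | false = sym (zeroʳ c)

  restrictTo : Fin n → Fin n → ArcFun → ArcFun
  restrictTo a b g u v = if atArc a b u v then g a b else 0#

  restrictTo-at : ∀ a b g → restrictTo a b g a b ≡ g a b
  restrictTo-at a b g = cong (λ c → if c then g a b else 0#) (atArc-refl a b)

  restrictTo-off : ∀ a b g {u v} → ¬ (u ≡ a × v ≡ b) → restrictTo a b g u v ≡ 0#
  restrictTo-off a b g ¬ab = cong (λ c → if c then g a b else 0#) (atArc-off ¬ab)

  cost-restrictTo : ∀ w {a b} g → adj a b ≡ true → cost w (restrictTo a b g) ≡ w a b * g a b
  cost-restrictTo w {a} {b} g ab = begin
    cost w (restrictTo a b g)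
      ≡⟨ ∑-single {f = λ u → ∑ (weigh w (restrictTo a b g) u)} a
                  (λ u u≢a → ∑-zero (λ v → off {u} {v} (u≢a ∘ proj₁))) ⟩
    ∑ (weigh w (restrictTo a b g) a)
      ≡⟨ ∑-single {f = weigh w (restrictTo a b g) a} b (λ v v≢b → off {a} {v} (v≢b ∘ proj₂)) ⟩
    weigh w (restrictTo a b g) a b
      ≡⟨ cong (λ c → if c then w a b * restrictTo a b g a b else 0#) ab ⟩
    w a b * restrictTo a b g a b
      ≡⟨ cong (w a b *_) (restrictTo-at a b g) ⟩
    w a b * g a b
      ∎
    where
    off : ∀ {u v} → ¬ (u ≡ a × v ≡ b) → weigh w (restrictTo a b g) u v ≡ 0#
    off ¬ab = weigh-zero w (restrictTo a b g) (restrictTo-off a b g ¬ab)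

  cutTwoCycle : Fin n → Fin n → ArcFun → ArcFun
  cutTwoCycle a b g u v = caseArcs a b 0# 0# (g u v) u v

  g≡cutTwoCycle+restrictTo : ∀ {a b} g → a ≢ b → ∀ u v →
    g u v ≡ cutTwoCycle a b g u v + (restrictTo a b g u v + restrictTo b a g u v)
  g≡cutTwoCycle+restrictTo {a} {b} g a≢b u v with arcView a b u v
  ... | forward refl refl = sym (begin
    cutTwoCycle a b g a b + (restrictTo a b g a b + restrictTo b a g a b)
      ≡⟨ cong₂ _+_ (caseArcs-forward {a = a} {b})
                   (cong₂ _+_ (restrictTo-at a b g) (restrictTo-off b a g {a} {b} (a≢b ∘ proj₁))) ⟩
    0# + (g a b + 0#)  ≡⟨ trans (+-identityˡ _) (+-identityʳ (g a b)) ⟩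
    g a b              ∎)
  ... | backward refl refl = sym (begin
    cutTwoCycle a b g b a + (restrictTo a b g b a + restrictTo b a g b a)
      ≡⟨ cong₂ _+_ (caseArcs-backward a≢b)
                   (cong₂ _+_ (restrictTo-off a b g {b} {a} (a≢b ∘ sym ∘ proj₁))
                              (restrictTo-at b a g)) ⟩
    0# + (0# + g b a)  ≡⟨ trans (+-identityˡ _) (+-identityˡ (g b a)) ⟩
    g b a              ∎)
  ... | neither ¬ab ¬ba = sym (begin
    cutTwoCycle a b g u v + (restrictTo a b g u v + restrictTo b a g u v)
      ≡⟨ cong₂ _+_ (caseArcs-neither ¬ab ¬ba)
                   (cong₂ _+_ (restrictTo-off a b g ¬ab) (restrictTo-off b a g ¬ba)) ⟩
    g u v + (0# + 0#)  ≡⟨ trans (cong (λ s → g u v + s) (+-identityˡ 0#)) (+-identityʳ (g u v)) ⟩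
    g u v              ∎)

  cost-cutTwoCycle : ∀ w {a b} g → adj a b ≡ true →
    cost w g ≡ cost w (cutTwoCycle a b g) + (w a b * g a b + w b a * g b a)
  cost-cutTwoCycle w {a} {b} g ab = begin
    cost w g
      ≡⟨ cost-cong w (g≡cutTwoCycle+restrictTo g (adj⇒≢ ab)) ⟩
    cost w (λ u v → cutTwoCycle a b g u v + (restrictTo a b g u v + restrictTo b a g u v))
      ≡⟨ cost-distrib-+ w (cutTwoCycle a b g) _ ⟩
    cost w (cutTwoCycle a b g) + cost w (λ u v → restrictTo a b g u v + restrictTo b a g u v)
      ≡⟨ cong (λ s → cost w (cutTwoCycle a b g) + s)
              (cost-distrib-+ w (restrictTo a b g) (restrictTo b a g)) ⟩
    cost w (cutTwoCycle a b g) + (cost w (restrictTo a b g) + cost w (restrictTo b a g))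
      ≡⟨ cong (λ s → cost w (cutTwoCycle a b g) + s)
              (cong₂ _+_ (cost-restrictTo w g ab) (cost-restrictTo w g (adj-reverse ab))) ⟩
    cost w (cutTwoCycle a b g) + (w a b * g a b + w b a * g b a)
      ∎

  VanishesOutside : ArcSet n → Fin n → Fin n → ArcFun → Set
  VanishesOutside D a b g =
    ∀ u v → D u v ≡ false → ¬ (u ≡ a × v ≡ b) → ¬ (u ≡ b × v ≡ a) → g u v ≡ 0#

  cutTwoCycle-isDFlowOn : ∀ {D a b g} → adj a b ≡ true → IsDFlow d g →
    VanishesOutside D a b g → g a b ≡ g b a → IsDFlowOn d D (cutTwoCycle a b g)
  cutTwoCycle-isDFlowOn {D} {a} {b} {g} ab (bounded , off-E , conserved) off-D gab≡gba =
    ( (λ u v uv → cut-elim (λ c → (0# ≤ c) × (c ≤ 1#)) (≤-refl , 0≤1) u v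
                    (λ _ _ → bounded u v uv))
    , (λ u v uv → cut-elim (_≡ 0#) refl u v (λ _ _ → off-E u v uv))
    , (λ u → trans (∑-cong (cut-antisymmetric-part u)) (conserved u)) )
    , (λ u v Duv → cut-elim (_≡ 0#) refl u v (off-D u v Duv))
    where
    a≢b : a ≢ b
    a≢b = adj⇒≢ ab
    cut-elim : (P : Carrier → Set) → P 0# → ∀ u v →
      (¬ (u ≡ a × v ≡ b) → ¬ (u ≡ b × v ≡ a) → P (g u v)) → P (cutTwoCycle a b g u v)
    cut-elim P p0 u v = caseArcs-elim P a≢b p0 p0 u v
    cut-antisymmetric-part : ∀ u v →
      cutTwoCycle a b g u v - cutTwoCycle a b g v u ≡ g u v - g v u
    cut-antisymmetric-part u v with arcView a b u v
    ... | forward refl refl =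
      trans (cong₂ _-_ (caseArcs-forward {a = a} {b}) (caseArcs-backward a≢b))
            (trans (-‿inverseʳ 0#) (sym (x≈y⇒x∙y⁻¹≈ε gab≡gba)))
    ... | backward refl refl =
      trans (cong₂ _-_ (caseArcs-backward a≢b) (caseArcs-forward {a = a} {b}))
            (trans (-‿inverseʳ 0#) (sym (x≈y⇒x∙y⁻¹≈ε (sym gab≡gba))))
    ... | neither ¬ab ¬ba =
      cong₂ _-_ (caseArcs-neither ¬ab ¬ba) (caseArcs-neither (¬ba ∘ swap) (¬ab ∘ swap))

  minCost<twoCycleFlow : ∀ {w D f g a b} → (∀ u v → adj u v ≡ true → 0# < w u v) →
    IsMinCostOn d w D f → adj a b ≡ true → IsDFlow d g → VanishesOutside D a b g →
    g a b ≡ g b a → 0# < g a b → cost w f < cost w g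
  minCost<twoCycleFlow {w} {g = g} {a} {b} w-pos (_ , f-min) ab g-flow off-D gab≡gba 0<gab =
    ≤-<-trans (f-min (cutTwoCycle a b g) (cutTwoCycle-isDFlowOn ab g-flow off-D gab≡gba))
      (subst (cost w (cutTwoCycle a b g) <_) (sym (cost-cutTwoCycle w g ab))
        (x<x+y _ (+-pos (*-pos (w-pos a b ab) 0<gab)
                        (*-pos (w-pos b a (adj-reverse ab)) (subst (0# <_) gab≡gba 0<gab)))))

  midpoint : ArcFun → ArcFun → ArcFun
  midpoint g₁ g₂ u v = ½ * (g₁ u v + g₂ u v)

  midpoint-zero : ∀ g₁ g₂ {u v} → g₁ u v ≡ 0# → g₂ u v ≡ 0# → midpoint g₁ g₂ u v ≡ 0#
  midpoint-zero g₁ g₂ g₁≡0 g₂≡0 =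
    trans (cong (½ *_) (trans (cong₂ _+_ g₁≡0 g₂≡0) (+-identityˡ 0#))) (zeroʳ ½)

  midpoint-isDFlow : ∀ {g₁ g₂} → IsDFlow d g₁ → IsDFlow d g₂ → IsDFlow d (midpoint g₁ g₂)
  midpoint-isDFlow {g₁} {g₂} (bounded₁ , off₁ , conserved₁) (bounded₂ , off₂ , conserved₂) =
    bounded , (λ u v uv → midpoint-zero g₁ g₂ (off₁ u v uv) (off₂ u v uv)) , conserved
    where
    bounded : ∀ u v → adj u v ≡ true → (0# ≤ midpoint g₁ g₂ u v) × (midpoint g₁ g₂ u v ≤ 1#)
    bounded u v uv with bounded₁ u v uv | bounded₂ u v uv
    ... | 0≤g₁ , g₁≤1 | 0≤g₂ , g₂≤1 =
      *-nonneg (proj₁ 0<½) (+-nonneg 0≤g₁ 0≤g₂) ,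
      subst (midpoint g₁ g₂ u v ≤_) (½*[x+x]≡x 1#)
        (*-monoʳ-≤-nonneg (proj₁ 0<½) (+-mono-≤₂ g₁≤1 g₂≤1))
    conserved : ∀ u → ∑ (λ v → midpoint g₁ g₂ u v - midpoint g₁ g₂ v u) ≡ fromℤ (d u)
    conserved u = begin
      ∑ (λ v → midpoint g₁ g₂ u v - midpoint g₁ g₂ v u)
        ≡⟨ ∑-cong (λ v → c*[x+y]-c*[x′+y′] ½ (g₁ u v) (g₂ u v) (g₁ v u) (g₂ v u)) ⟩
      ∑ (λ v → ½ * ((g₁ u v - g₁ v u) + (g₂ u v - g₂ v u)))
        ≡⟨ *-distribˡ-∑ ½ (λ v → (g₁ u v - g₁ v u) + (g₂ u v - g₂ v u)) ⟨
      ½ * ∑ (λ v → (g₁ u v - g₁ v u) + (g₂ u v - g₂ v u))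
        ≡⟨ cong (½ *_) (∑-distrib-+ (λ v → g₁ u v - g₁ v u) (λ v → g₂ u v - g₂ v u)) ⟩
      ½ * (∑ (λ v → g₁ u v - g₁ v u) + ∑ (λ v → g₂ u v - g₂ v u))
        ≡⟨ cong (½ *_) (cong₂ _+_ (conserved₁ u) (conserved₂ u)) ⟩
      ½ * (fromℤ (d u) + fromℤ (d u))
        ≡⟨ ½*[x+x]≡x (fromℤ (d u)) ⟩
      fromℤ (d u)
        ∎

  cost-midpoint : ∀ w g₁ g₂ → cost w (midpoint g₁ g₂) ≡ ½ * (cost w g₁ + cost w g₂)
  cost-midpoint w g₁ g₂ =
    trans (cost-scale w ½ (λ u v → g₁ u v + g₂ u v)) (cong (½ *_) (cost-distrib-+ w g₁ g₂))

  midpoint-cost-≤ : ∀ w {g₁ g₂ c} → cost w g₁ ≤ c → cost w g₂ ≤ c → cost w (midpoint g₁ g₂) ≤ c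
  midpoint-cost-≤ w {g₁} {g₂} {c} g₁≤c g₂≤c =
    subst₂ _≤_ (sym (cost-midpoint w g₁ g₂)) (½*[x+x]≡x c)
      (*-monoʳ-≤-nonneg (proj₁ 0<½) (+-mono-≤₂ g₁≤c g₂≤c))

  module _ {D : ArcSet n} {a b : Fin n} (ab : adj a b ≡ true) where

    private
      a≢b : a ≢ b
      a≢b = adj⇒≢ ab

    isDFlowOn-⊕ : ∀ {g} → IsDFlowOn d D g → g b a ≡ 0# → IsDFlowOn d (D ⊕ arcOf ab) g
    isDFlowOn-⊕ {g} (g-flow , off) gba≡0 = g-flow , vanish
      where
      vanish : ∀ u v → (D ⊕ arcOf ab) u v ≡ false → g u v ≡ 0#
      vanish u v X≡false with arcView a b u v
      ... | forward refl refl  = false≢true (trans (sym X≡false) (caseArcs-forward {a = a} {b}))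
      ... | backward refl refl = gba≡0
      ... | neither ¬ab ¬ba    = off u v (trans (sym (caseArcs-neither ¬ab ¬ba)) X≡false)

    ⊕-isDFlowOn : ∀ {g} → IsDFlowOn d (D ⊕ arcOf ab) g → (D a b ≡ false → g a b ≡ 0#) →
                  IsDFlowOn d D g
    ⊕-isDFlowOn {g} (g-flow , off) gab≡0 = g-flow , vanish
      where
      vanish : ∀ u v → D u v ≡ false → g u v ≡ 0#
      vanish u v D≡false with arcView a b u v
      ... | forward refl refl  = gab≡0 D≡false
      ... | backward refl refl = off b a (caseArcs-backward a≢b)
      ... | neither ¬ab ¬ba    = off u v (trans (caseArcs-neither ¬ab ¬ba) D≡false)

    ⊕-reverse-zero : ∀ {g} → IsDFlowOn d (D ⊕ arcOf ab) g → g b a ≡ 0#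
    ⊕-reverse-zero (_ , off) = off b a (caseArcs-backward a≢b)

    ⊕-vanishesOutside : ∀ {g} → IsDFlowOn d (D ⊕ arcOf ab) g → VanishesOutside D a b g
    ⊕-vanishesOutside (_ , off) u v D≡false ¬ab ¬ba =
      off u v (trans (caseArcs-neither ¬ab ¬ba) D≡false)

module ArcInsertion (F : OrderedField) {n : ℕ} (G : SimpleGraph n)
    (d : Fin n → ℤ) (w : Fin n → Fin n → OrderedField.Carrier F)
    (w-pos : ∀ u v → SimpleGraph.adj G u v ≡ true → OrderedField._<_ F (OrderedField.0# F) (w u v))
    (H : Flows.StandingAssumption F G d w)
    (D : ArcSet n) (s : D ⊆E G) (p : Flows.InDf F G d D) where
  open OrderedField F
  open OrderedFieldProperties F
  open SimpleGraph G using (adj)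
  open Flows F G
  open FlowProperties F G d
  open ≡-Reasoning

  minFlow : (X : ArcSet n) → X ⊆E G → InDf d X → ArcFun
  minFlow X sX q = proj₁ (H X sX q)

  f : ArcFun
  f = minFlow D s p

  f-minCost : IsMinCostOn d w D f
  f-minCost = proj₁ (proj₂ (H D s p))

  f-01 : ∀ u v → (f u v ≡ 0#) ⊎ (f u v ≡ 1#)
  f-01 = proj₂ (proj₂ (proj₂ (H D s p)))

  f≡1⇒D≢false : ∀ {a b} → f a b ≡ 1# → ¬ (D a b ≡ false)
  f≡1⇒D≢false fab≡1 Dab≡false = 0≢1 (trans (sym (proj₂ (proj₁ f-minCost) _ _ Dab≡false)) fab≡1)

  Unchanged : (X : ArcSet n) → X ⊆E G → Set
  Unchanged X sX = Σ (InDf d X) λ q → SameArcs (A d w H X sX q) (A d w H D s p)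

  unchanged : ∀ X sX (fX : IsDFlowOn d X f) → IsDFlowOn d D (minFlow X sX (f , fX)) →
              Unchanged X sX
  unchanged X sX fX gD = (f , fX) , λ u v → mk⇔ (trans (f≡g u v)) (trans (sym (f≡g u v)))
    where
    g : ArcFun
    g = minFlow X sX (f , fX)
    g-minCost : IsMinCostOn d w X g
    g-minCost = proj₁ (proj₂ (H X sX (f , fX)))
    f-minCostX : IsMinCostOn d w X f
    f-minCostX = fX , λ h hX → ≤-trans (proj₂ f-minCost g gD) (proj₂ g-minCost h hX)
    f≡g : ∀ u v → f u v ≡ g u v
    f≡g = proj₁ (proj₂ (proj₂ (H X sX (f , fX)))) f f-minCostX

  module _ {a b} (ab : adj a b ≡ true) (fba≡0 : f b a ≡ 0#) where

    f-on-⊕ : IsDFlowOn d (D ⊕ arcOf ab) f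
    f-on-⊕ = isDFlowOn-⊕ ab (proj₁ f-minCost) fba≡0

    A⊕ : ArcFun
    A⊕ = minFlow (D ⊕ arcOf ab) (⊕-⊆E D (arcOf ab) s) (f , f-on-⊕)

    A⊕-minCost : IsMinCostOn d w (D ⊕ arcOf ab) A⊕
    A⊕-minCost = proj₁ (proj₂ (H (D ⊕ arcOf ab) (⊕-⊆E D (arcOf ab) s) (f , f-on-⊕)))

    A⊕-01 : ∀ u v → (A⊕ u v ≡ 0#) ⊎ (A⊕ u v ≡ 1#)
    A⊕-01 = proj₂ (proj₂ (proj₂ (H (D ⊕ arcOf ab) (⊕-⊆E D (arcOf ab) s) (f , f-on-⊕))))

    unchanged-⊕ : (D a b ≡ false → A⊕ a b ≡ 0#) → Unchanged (D ⊕ arcOf ab) (⊕-⊆E D (arcOf ab) s)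
    unchanged-⊕ A⊕-off = unchanged _ _ f-on-⊕ (⊕-isDFlowOn ab (proj₁ A⊕-minCost) A⊕-off)

  no-unit-twoCycle : ∀ {a b} → adj a b ≡ true → f a b ≡ 1# → f b a ≡ 1# → ⊥
  no-unit-twoCycle ab fab≡1 fba≡1 =
    <⇒≱ (minCost<twoCycleFlow w-pos f-minCost ab (proj₁ (proj₁ f-minCost))
           (λ u v D≡false _ _ → proj₂ (proj₁ f-minCost) u v D≡false)
           (trans fab≡1 (sym fba≡1)) (subst (0# <_) (sym fab≡1) 0<1))
        ≤-refl

  no-opposite-unit-A⊕ : ∀ {a b} (ab : adj a b ≡ true) (fab≡0 : f a b ≡ 0#) (fba≡0 : f b a ≡ 0#) →
    A⊕ ab fba≡0 a b ≡ 1# → A⊕ (adj-reverse ab) fab≡0 b a ≡ 1# → ⊥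
  no-opposite-unit-A⊕ {a} {b} ab fab≡0 fba≡0 g₁ab≡1 g₂ba≡1 =
    <⇒≱ (minCost<twoCycleFlow w-pos f-minCost ab (midpoint-isDFlow (proj₁ g₁-on) (proj₁ g₂-on))
           g-off (trans g-ab≡½ (sym g-ba≡½)) (subst (0# <_) (sym g-ab≡½) 0<½))
        (midpoint-cost-≤ w (costs-≤-f (A⊕-minCost ab fba≡0) (f-on-⊕ ab fba≡0))
                           (costs-≤-f (A⊕-minCost ba fab≡0) (f-on-⊕ ba fab≡0)))
    where
    ba : adj b a ≡ true
    ba = adj-reverse ab
    g₁ g₂ g : ArcFun
    g₁ = A⊕ ab fba≡0
    g₂ = A⊕ ba fab≡0
    g = midpoint g₁ g₂
    g₁-on : IsDFlowOn d (D ⊕ arcOf ab) g₁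
    g₁-on = proj₁ (A⊕-minCost ab fba≡0)
    g₂-on : IsDFlowOn d (D ⊕ arcOf ba) g₂
    g₂-on = proj₁ (A⊕-minCost ba fab≡0)
    costs-≤-f : ∀ {X h} → IsMinCostOn d w X h → IsDFlowOn d X f → cost w h ≤ cost w f
    costs-≤-f (_ , h-min) fX = h-min f fX
    g-off : VanishesOutside D a b g
    g-off u v D≡false ¬ab ¬ba = midpoint-zero g₁ g₂
      (⊕-vanishesOutside ab g₁-on u v D≡false ¬ab ¬ba)
      (⊕-vanishesOutside ba g₂-on u v D≡false ¬ba ¬ab)
    g-ab≡½ : g a b ≡ ½
    g-ab≡½ = begin
      ½ * (g₁ a b + g₂ a b)  ≡⟨ cong₂ (λ x y → ½ * (x + y)) g₁ab≡1 (⊕-reverse-zero ba g₂-on) ⟩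
      ½ * (1# + 0#)          ≡⟨ cong (½ *_) (+-identityʳ 1#) ⟩
      ½ * 1#                 ≡⟨ *-identityʳ ½ ⟩
      ½                      ∎
    g-ba≡½ : g b a ≡ ½
    g-ba≡½ = begin
      ½ * (g₁ b a + g₂ b a)  ≡⟨ cong₂ (λ x y → ½ * (x + y)) (⊕-reverse-zero ab g₁-on) g₂ba≡1 ⟩
      ½ * (0# + 1#)          ≡⟨ cong (½ *_) (+-identityˡ 1#) ⟩
      ½ * 1#                 ≡⟨ *-identityʳ ½ ⟩
      ½                      ∎

  ⊕-or-⊕rev-unchanged : (e : Arc G) →
    Unchanged (D ⊕ e) (⊕-⊆E D e s) ⊎ Unchanged (D ⊕ rev e) (⊕-⊆E D (rev e) s)
  ⊕-or-⊕rev-unchanged (arc a b ab) with f-01 a b | f-01 b a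
  ... | inj₂ fab≡1 | inj₂ fba≡1 = ⊥-elim (no-unit-twoCycle ab fab≡1 fba≡1)
  ... | inj₂ fab≡1 | inj₁ fba≡0 = inj₁ (unchanged-⊕ ab fba≡0 (⊥-elim ∘ f≡1⇒D≢false fab≡1))
  ... | inj₁ fab≡0 | inj₂ fba≡1 =
    inj₂ (unchanged-⊕ (adj-reverse ab) fab≡0 (⊥-elim ∘ f≡1⇒D≢false fba≡1))
  ... | inj₁ fab≡0 | inj₁ fba≡0 with A⊕-01 ab fba≡0 a b | A⊕-01 (adj-reverse ab) fab≡0 b a
  ...   | inj₁ g₁ab≡0 | _           = inj₁ (unchanged-⊕ ab fba≡0 (λ _ → g₁ab≡0))
  ...   | inj₂ _      | inj₁ g₂ba≡0 = inj₂ (unchanged-⊕ (adj-reverse ab) fab≡0 (λ _ → g₂ba≡0))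
  ...   | inj₂ g₁ab≡1 | inj₂ g₂ba≡1 =
    ⊥-elim (no-opposite-unit-A⊕ ab fab≡0 fba≡0 g₁ab≡1 g₂ba≡1)

lemma1 : (F : OrderedField) {n : ℕ} (G : SimpleGraph n)
         (d : Fin n → ℤ) (w : Fin n → Fin n → OrderedField.Carrier F) →
         ∑ℤ d ≡ + 0 →
         (∀ u v → SimpleGraph.adj G u v ≡ true → OrderedField._<_ F (OrderedField.0# F) (w u v)) →
         (H : Flows.StandingAssumption F G d w) →
         (D : ArcSet n) (s : D ⊆E G) (p : Flows.InDf F G d D) (e : Arc G) →
         (Σ (Flows.InDf F G d (D ⊕ e)) λ q →
            Flows.SameArcs F G (Flows.A F G d w H (D ⊕ e) (Flows.⊕-⊆E F G D e s) q)
                               (Flows.A F G d w H D s p))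
         ⊎
         (Σ (Flows.InDf F G d (D ⊕ rev e)) λ q →
            Flows.SameArcs F G (Flows.A F G d w H (D ⊕ rev e) (Flows.⊕-⊆E F G D (rev e) s) q)
                               (Flows.A F G d w H D s p))
lemma1 F G d w _ w-pos H D s p = ArcInsertion.⊕-or-⊕rev-unchanged F G d w w-pos H D s p
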